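{- Let $x,a\in\mathbb{R}_{\max}^n\setminus\{\bot\}$ and let $i^*\in\arg\max_{i\in[n]}(x_i+a_i)$. Then $$\mathrm{dist}_H(x,\mathcal H_a)=x_{i^*}+a_{i^*}-\max_{i\in[n],i\ne i^*}(x_i+a_i),$$ with the convention $(-\infty)-(-\infty)=0$.
   Context: $\mathbb{R}_{\max}=\mathbb{R}\cup\{ -\infty\}$, $\bot$ the all-$(-\infty)$ vector; for $c\in\mathbb{R}$, $c-(-\infty)=+\infty$. $\mathcal H_a=\{y\in\mathbb{R}_{\max}^n\mid\max_i(a_i+y_i)$ is achieved by at least two indices$\}$. Hilbert's projective metric: for $x,y$ not both $\bot$, $d(x,y)=\inf\{\lambda-\mu\mid\lambda,\mu\in\mathbb{R},\ \mu+y_i\le x_i\le\lambda+y_i\ \forall i\}\in[0,+\infty]$, $d(\bot,\bot)=0$; $\mathrm{dist}_H(x,B)=\inf_{y\in B}d(x,y)$. -}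

module Defs where

open import Level using (0ℓ)
open import Data.Nat using (ℕ; zero; suc)
open import Data.Fin using (Fin; zero; suc; _≟_)
open import Data.Bool using (if_then_else_)
open import Data.Product using (Σ; ∃; _×_; _,_)
open import Data.Sum using (_⊎_)
open import Relation.Nullary using (¬_; yes; no; does)
open import Relation.Binary using (Decidable; IsTotalOrder)
open import Relation.Binary.PropositionalEquality using (_≡_; _≢_)
open import Algebra.Structures using (IsCommutativeRing)

-- An axiomatisation of the (classical) real numbers: a complete
-- totally ordered field (with decidable order, as in classical math).
-- Every model is isomorphic to ℝ, so quantifying over all models
-- is the same as speaking about ℝ.

record Reals : Set₁ where
  infixl 6 _+_
  infixl 7 _*_
  infix  4 _≤_
  field
    Carrier : Set
    _+_ _*_ : Carrier → Carrier → Carrier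
    -_      : Carrier → Carrier
    0# 1#   : Carrier
    _≤_     : Carrier → Carrier → Set
    isCommutativeRing : IsCommutativeRing _≡_ _+_ _*_ -_ 0# 1#
    0≢1     : 0# ≢ 1#
    inverse : ∀ x → x ≢ 0# → ∃ λ y → x * y ≡ 1#
    isTotalOrder : IsTotalOrder _≡_ _≤_
    _≤?_    : Decidable _≤_
    +-mono  : ∀ {x y} z → x ≤ y → x + z ≤ y + z
    *-pos   : ∀ {x y} → 0# ≤ x → 0# ≤ y → 0# ≤ x * y
    complete : (S : Carrier → Set) → (∃ λ s → S s) →
               (∃ λ b → ∀ s → S s → s ≤ b) →
               ∃ λ u → (∀ s → S s → s ≤ u) ×
                       (∀ b → (∀ s → S s → s ≤ b) → u ≤ b)

module Over (R : Reals) where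
  open Reals R

  _-_ : Carrier → Carrier → Carrier
  x - y = x + (- y)

  data Rmax : Set where
    -∞  : Rmax
    fin : Carrier → Rmax

  _⊕_ : Rmax → Rmax → Rmax
  -∞    ⊕ _     = -∞
  fin _ ⊕ -∞    = -∞
  fin r ⊕ fin s = fin (r + s)

  data _≤m_ : Rmax → Rmax → Set where
    -∞≤   : ∀ {y} → -∞ ≤m y
    fin≤  : ∀ {r s} → r ≤ s → fin r ≤m fin s

  maxm : Rmax → Rmax → Rmax
  maxm -∞ y = y
  maxm x -∞ = x
  maxm (fin r) (fin s) with r ≤? s
  ... | yes _ = fin s
  ... | no  _ = fin r

  bigmax : ∀ {n} → (Fin n → Rmax) → Rmax
  bigmax {zero}  f = -∞
  bigmax {suc n} f = maxm (f zero) (bigmax (λ j → f (suc j)))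

  maxExcept : ∀ {n} → (Fin n → Rmax) → Fin n → Rmax
  maxExcept s i = bigmax (λ j → if does (j ≟ i) then -∞ else s j)

  data Ext : Set where
    ninf : Ext
    finE : Carrier → Ext
    pinf : Ext

  data _≤E_ : Ext → Ext → Set where
    ninf≤ : ∀ {y} → ninf ≤E y
    finE≤ : ∀ {r s} → r ≤ s → finE r ≤E finE s
    ≤pinf : ∀ {x} → x ≤E pinf

  _⊖_ : Rmax → Rmax → Ext
  -∞    ⊖ -∞    = finE 0#
  -∞    ⊖ fin _ = ninf
  fin _ ⊖ -∞    = pinf
  fin r ⊖ fin s = finE (r - s)

  IsInf : (Ext → Set) → Ext → Set
  IsInf S v = (∀ w → S w → v ≤E w) × (∀ v' → (∀ w → S w → v' ≤E w) → v' ≤E v)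

  Vecm : ℕ → Set
  Vecm n = Fin n → Rmax

  IsBot : ∀ {n} → Vecm n → Set
  IsBot x = ∀ i → x i ≡ -∞

  InH : ∀ {n} → Vecm n → Vecm n → Set
  InH {n} a y = Σ (Fin n) λ i → Σ (Fin n) λ j → i ≢ j × (a i ⊕ y i) ≡ (a j ⊕ y j)
                  × (∀ k → (a k ⊕ y k) ≤m (a i ⊕ y i))

  Feasible : ∀ {n} → Vecm n → Vecm n → Carrier → Carrier → Set
  Feasible x y l m = ∀ i → ((fin m ⊕ y i) ≤m x i) × (x i ≤m (fin l ⊕ y i))

  HilbertDist : ∀ {n} → Vecm n → Vecm n → Ext → Set
  HilbertDist x y v =
    (IsBot x × IsBot y × v ≡ finE 0#) ⊎
    (¬ (IsBot x × IsBot y) ×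
     IsInf (λ w → ∃ λ l → ∃ λ m → Feasible x y l m × w ≡ finE (l - m)) v)

  DistSet : ∀ {n} → Vecm n → Vecm n → Ext → Set
  DistSet x a w = ∃ λ y → InH a y × HilbertDist x y w

  IsDistH : ∀ {n} → Vecm n → Vecm n → Ext → Set
  IsDistH x a v = IsInf (DistSet x a) v

{-# OPTIONS --safe #-}
module Submission where

open import Level using (0ℓ)
open import Data.Nat using (zero; suc)
open import Data.Fin using (Fin; zero; suc; _≟_)
open import Data.Fin.Properties using (¬∀⟶∃¬)
open import Data.Vec.Functional using (updateAt)
open import Data.Vec.Functional.Properties using (updateAt-updates; updateAt-minimal)
open import Data.Bool using (if_then_else_)
open import Data.Product using (∃; _×_; _,_; proj₁; proj₂)
open import Data.Sum using (_⊎_; inj₁; inj₂)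
open import Data.Empty using (⊥-elim)
open import Function using (_∘_)
open import Relation.Nullary using (¬_; Dec; yes; no; does)
open import Relation.Binary using (IsTotalOrder)
open import Relation.Binary.Bundles using (Preorder)
open import Relation.Binary.PropositionalEquality
open import Algebra.Bundles using (CommutativeRing; CommutativeSemigroup)
import Algebra.Properties.CommutativeSemigroup
import Relation.Binary.Reasoning.Preorder
open import Defs

-- Write s j = x j + a j, μ = s i* and σ = max_{j ≠ i*} s j.  If y ∈ H_a and m + y ≤ x ≤ l + y
-- coordinatewise, the maximum t of a + y is attained at some p ≠ i*, so μ ≤ l + t and
-- m + t ≤ s p ≤ σ, whence μ - σ ≤ l - m.  Conversely, lowering x i* by μ - σ ties it with the
-- runner-up and gives a point of H_a at distance exactly μ - σ.  In the degenerate cases either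
-- σ = -∞ < μ, and then no pair (l, m) is feasible for any y ∈ H_a, so the distance is +∞; or
-- μ = σ = -∞, and then x itself lies on H_a.

module OrderedField (R : Reals) where
  open Reals R
  open Over R using (_-_)

  commutativeRing : CommutativeRing 0ℓ 0ℓ
  commutativeRing = record { isCommutativeRing = isCommutativeRing }

  open CommutativeRing commutativeRing public
    using (+-assoc; +-comm; +-identityˡ; +-identityʳ; -‿inverseˡ; -‿inverseʳ)
  open CommutativeRing commutativeRing using (+-abelianGroup; +-commutativeSemigroup)
  open import Algebra.Properties.AbelianGroup +-abelianGroup using (⁻¹-anti-homo‿-; ε⁻¹≈ε)
  open import Algebra.Properties.CommutativeSemigroup +-commutativeSemigroup using (interchange)
  open ≡-Reasoning

  x≤y⇒0≤y-x : ∀ {x y} → x ≤ y → 0# ≤ y - x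
  x≤y⇒0≤y-x {x} {y} x≤y = subst (_≤ y - x) (-‿inverseʳ x) (+-mono (- x) x≤y)

  0≤x⇒-x≤0 : ∀ {x} → 0# ≤ x → - x ≤ 0#
  0≤x⇒-x≤0 {x} 0≤x = subst₂ _≤_ (+-identityˡ (- x)) (-‿inverseʳ x) (+-mono (- x) 0≤x)

  m+a≤l+b⇒a-b≤l-m : ∀ {l m a b} → m + a ≤ l + b → a - b ≤ l - m
  m+a≤l+b⇒a-b≤l-m {l} {m} {a} {b} p = subst₂ _≤_ lhs rhs (+-mono (- m + - b) p)
    where
    lhs : (m + a) + (- m + - b) ≡ a - b
    lhs = begin
      (m + a) + (- m + - b) ≡⟨ interchange m a (- m) (- b) ⟩
      (m - m) + (a - b)     ≡⟨ cong (_+ (a - b)) (-‿inverseʳ m) ⟩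
      0# + (a - b)          ≡⟨ +-identityˡ (a - b) ⟩
      a - b                 ∎
    rhs : (l + b) + (- m + - b) ≡ l - m
    rhs = begin
      (l + b) + (- m + - b) ≡⟨ interchange l b (- m) (- b) ⟩
      (l - m) + (b - b)     ≡⟨ cong ((l - m) +_) (-‿inverseʳ b) ⟩
      (l - m) + 0#          ≡⟨ +-identityʳ (l - m) ⟩
      l - m                 ∎

  -[a-b]+a≡b : ∀ a b → - (a - b) + a ≡ b
  -[a-b]+a≡b a b = begin
    - (a - b) + a     ≡⟨ cong (_+ a) (⁻¹-anti-homo‿- a b) ⟩
    (b - a) + a       ≡⟨ +-assoc b (- a) a ⟩
    b + (- a + a)     ≡⟨ cong (b +_) (-‿inverseˡ a) ⟩
    b + 0#            ≡⟨ +-identityʳ b ⟩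
    b                 ∎

  x-0≡x : ∀ x → x - 0# ≡ x
  x-0≡x x = trans (cong (x +_) ε⁻¹≈ε) (+-identityʳ x)

module TropicalMax (R : Reals) where
  open Reals R using (_+_; 0#; _≤_; _≤?_; +-mono; isTotalOrder)
  open IsTotalOrder isTotalOrder using (total) renaming (refl to ≤-refl; trans to ≤-trans)
  open OrderedField R using (+-comm; +-assoc; +-identityˡ)
  open Over R

  ≤m-refl : ∀ {x} → x ≤m x
  ≤m-refl { -∞}   = -∞≤
  ≤m-refl {fin r} = fin≤ ≤-refl

  ≤m-reflexive : ∀ {x y} → x ≡ y → x ≤m y
  ≤m-reflexive refl = ≤m-refl

  ≤m-trans : ∀ {x y z} → x ≤m y → y ≤m z → x ≤m z
  ≤m-trans -∞≤      _        = -∞≤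
  ≤m-trans (fin≤ p) (fin≤ q) = fin≤ (≤-trans p q)

  ≤m-preorder : Preorder 0ℓ 0ℓ 0ℓ
  ≤m-preorder = record
    { isPreorder = record { isEquivalence = isEquivalence ; reflexive = ≤m-reflexive ; trans = ≤m-trans } }

  x≤m-∞⇒x≡-∞ : ∀ {x} → x ≤m -∞ → x ≡ -∞
  x≤m-∞⇒x≡-∞ -∞≤ = refl

  fin≢-∞ : ∀ {r} → fin r ≢ -∞
  fin≢-∞ ()

  ≟-∞ : ∀ x → Dec (x ≡ -∞)
  ≟-∞ -∞      = yes refl
  ≟-∞ (fin _) = no λ ()

  maxm-upperˡ : ∀ x y → x ≤m maxm x y
  maxm-upperˡ -∞      y       = -∞≤
  maxm-upperˡ (fin r) -∞      = ≤m-refl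
  maxm-upperˡ (fin r) (fin s) with r ≤? s
  ... | yes r≤s = fin≤ r≤s
  ... | no  _   = ≤m-refl

  maxm-upperʳ : ∀ x y → y ≤m maxm x y
  maxm-upperʳ -∞      y       = ≤m-refl
  maxm-upperʳ (fin r) -∞      = -∞≤
  maxm-upperʳ (fin r) (fin s) with r ≤? s | total r s
  ... | yes _   | _        = ≤m-refl
  ... | no  r≰s | inj₁ r≤s = ⊥-elim (r≰s r≤s)
  ... | no  _   | inj₂ s≤r = fin≤ s≤r

  maxm-least : ∀ {x y z} → x ≤m z → y ≤m z → maxm x y ≤m z
  maxm-least { -∞}            _   y≤z = y≤z
  maxm-least {fin r} { -∞}    x≤z _   = x≤z
  maxm-least {fin r} {fin s} x≤z y≤z with r ≤? s
  ... | yes _ = y≤z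
  ... | no  _ = x≤z

  maxm-fin : ∀ x y {c} → maxm x y ≡ fin c → x ≡ fin c ⊎ y ≡ fin c
  maxm-fin -∞      y       eq = inj₂ eq
  maxm-fin (fin r) -∞      eq = inj₁ eq
  maxm-fin (fin r) (fin s) eq with r ≤? s
  ... | yes _ = inj₂ eq
  ... | no  _ = inj₁ eq

  bigmax-upper : ∀ {n} (f : Fin n → Rmax) k → f k ≤m bigmax f
  bigmax-upper f zero    = maxm-upperˡ (f zero) _
  bigmax-upper f (suc k) = ≤m-trans (bigmax-upper (f ∘ suc) k) (maxm-upperʳ (f zero) _)

  bigmax-least : ∀ {n} (f : Fin n → Rmax) {b} → (∀ k → f k ≤m b) → bigmax f ≤m b
  bigmax-least {zero}  f f≤b = -∞≤
  bigmax-least {suc n} f f≤b = maxm-least (f≤b zero) (bigmax-least (f ∘ suc) (f≤b ∘ suc))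

  bigmax-attained : ∀ {n} (f : Fin n → Rmax) {c} → bigmax f ≡ fin c → ∃ λ k → f k ≡ fin c
  bigmax-attained {zero}  f ()
  bigmax-attained {suc n} f eq with maxm-fin (f zero) (bigmax (f ∘ suc)) eq
  ... | inj₁ f0≡c = zero , f0≡c
  ... | inj₂ rest≡c with bigmax-attained (f ∘ suc) rest≡c
  ...   | k , fk≡c = suc k , fk≡c

  private
    except : ∀ {n} → (Fin n → Rmax) → Fin n → Fin n → Rmax
    except s i j = if does (j ≟ i) then -∞ else s j

    except-≢ : ∀ {n} (s : Fin n → Rmax) {i j} → j ≢ i → except s i j ≡ s j
    except-≢ s {i} {j} j≢i with j ≟ i
    ... | yes j≡i = ⊥-elim (j≢i j≡i)
    ... | no  _   = refl

  maxExcept-upper : ∀ {n} (s : Fin n → Rmax) {i j} → j ≢ i → s j ≤m maxExcept s i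
  maxExcept-upper s {i} {j} j≢i =
    subst (_≤m maxExcept s i) (except-≢ s j≢i) (bigmax-upper (except s i) j)

  maxExcept-least : ∀ {n} (s : Fin n → Rmax) i {b} → (∀ j → j ≢ i → s j ≤m b) → maxExcept s i ≤m b
  maxExcept-least s i s≤b = bigmax-least (except s i) bound
    where
    bound : ∀ j → except s i j ≤m _
    bound j with j ≟ i
    ... | yes _   = -∞≤
    ... | no  j≢i = s≤b j j≢i

  maxExcept-attained : ∀ {n} (s : Fin n → Rmax) i {c} → maxExcept s i ≡ fin c →
                       ∃ λ j → j ≢ i × s j ≡ fin c
  maxExcept-attained s i eq with bigmax-attained (except s i) eq
  ... | j , eʲ with j ≟ i
  ...   | yes _  = ⊥-elim (fin≢-∞ (sym eʲ))
  ...   | no j≢i = j , j≢i , eʲ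

  ⊕-comm : ∀ x y → x ⊕ y ≡ y ⊕ x
  ⊕-comm -∞      -∞      = refl
  ⊕-comm -∞      (fin _) = refl
  ⊕-comm (fin _) -∞      = refl
  ⊕-comm (fin r) (fin s) = cong fin (+-comm r s)

  ⊕-assoc : ∀ x y z → (x ⊕ y) ⊕ z ≡ x ⊕ (y ⊕ z)
  ⊕-assoc -∞      _       _       = refl
  ⊕-assoc (fin _) -∞      _       = refl
  ⊕-assoc (fin _) (fin _) -∞      = refl
  ⊕-assoc (fin r) (fin s) (fin t) = cong fin (+-assoc r s t)

  ⊕-commutativeSemigroup : CommutativeSemigroup 0ℓ 0ℓ
  ⊕-commutativeSemigroup = record
    { _∙_                     = _⊕_
    ; isCommutativeSemigroup = record
      { isSemigroup = record
        { isMagma = record { isEquivalence = isEquivalence ; ∙-cong = cong₂ _⊕_ }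
        ; assoc   = ⊕-assoc
        }
      ; comm = ⊕-comm
      }
    }

  ⊕-monoˡ-≤m : ∀ z {x y} → x ≤m y → (x ⊕ z) ≤m (y ⊕ z)
  ⊕-monoˡ-≤m z       -∞≤      = -∞≤
  ⊕-monoˡ-≤m -∞      (fin≤ _) = -∞≤
  ⊕-monoˡ-≤m (fin t) (fin≤ p) = fin≤ (+-mono t p)

  ⊕-monoʳ-≤m : ∀ z {x y} → x ≤m y → (z ⊕ x) ≤m (z ⊕ y)
  ⊕-monoʳ-≤m z {x} {y} x≤y = subst₂ _≤m_ (⊕-comm x z) (⊕-comm y z) (⊕-monoˡ-≤m z x≤y)

  fin-⊕-≤m : ∀ {c} x → c ≤ 0# → (fin c ⊕ x) ≤m x
  fin-⊕-≤m -∞      _   = -∞≤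
  fin-⊕-≤m {c} (fin r) c≤0 = fin≤ (subst (c + r ≤_) (+-identityˡ r) (+-mono r c≤0))

  ≤m-fin-⊕ : ∀ {c} x → 0# ≤ c → x ≤m (fin c ⊕ x)
  ≤m-fin-⊕ -∞      _   = -∞≤
  ≤m-fin-⊕ {c} (fin r) 0≤c = fin≤ (subst (_≤ c + r) (+-identityˡ r) (+-mono r 0≤c))

module HyperplaneDistance (R : Reals) where
  open Reals R using (Carrier; _+_; -_; 0#; _≤_; isTotalOrder)
  open IsTotalOrder isTotalOrder using () renaming (refl to ≤-refl; trans to ≤-trans)
  open OrderedField R
  open TropicalMax R
  open Over R
  open Algebra.Properties.CommutativeSemigroup ⊕-commutativeSemigroup
    using (x∙yz≈y∙xz; x∙yz≈y∙zx; xy∙z≈x∙zy)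

  nonBot⇒finite : ∀ {n} {x : Vecm n} → ¬ IsBot x → ∃ λ k → ∃ λ c → x k ≡ fin c
  nonBot⇒finite {n} {x} x≢⊥ with ¬∀⟶∃¬ n (λ k → x k ≡ -∞) (≟-∞ ∘ x) x≢⊥
  ... | k , xk≢-∞ with x k in xk≡
  ...   | -∞    = ⊥-elim (xk≢-∞ refl)
  ...   | fin c = k , c , xk≡

  FeasibleGap : ∀ {n} → Vecm n → Vecm n → Ext → Set
  FeasibleGap x y w = ∃ λ l → ∃ λ m → Feasible x y l m × w ≡ finE (l - m)

  isInf-intro : ∀ {S : Ext → Set} {v} → (∀ w → S w → v ≤E w) → v ≡ pinf ⊎ S v → IsInf S v
  isInf-intro lower (inj₁ refl) = lower , λ _ _ → ≤pinf
  isInf-intro lower (inj₂ v∈S)  = lower , λ _ v'≤S → v'≤S _ v∈S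

  feasible⇒0≤l-m : ∀ {n} {x y : Vecm n} {l m} → ¬ IsBot x → Feasible x y l m → 0# ≤ l - m
  feasible⇒0≤l-m {y = y} {l} {m} x≢⊥ feas with nonBot⇒finite x≢⊥
  ... | k , c , xk≡c =
    sandwich (y k) (subst (_ ≤m_) xk≡c (proj₁ (feas k))) (subst (_≤m _) xk≡c (proj₂ (feas k)))
    where
    sandwich : ∀ Y → (fin m ⊕ Y) ≤m fin c → fin c ≤m (fin l ⊕ Y) → 0# ≤ l - m
    sandwich -∞      _        ()
    sandwich (fin e) (fin≤ p) (fin≤ q) =
      subst (_≤ l - m) (-‿inverseʳ e) (m+a≤l+b⇒a-b≤l-m (≤-trans p q))

  hilbertDist-minimum : ∀ {n} {x y : Vecm n} {v l m} → ¬ IsBot x → Feasible x y l m → v ≡ l - m →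
                        (∀ {l' m'} → Feasible x y l' m' → finE v ≤E finE (l' - m')) →
                        HilbertDist x y (finE v)
  hilbertDist-minimum {x = x} {y} {v} x≢⊥ feas v≡l-m minimal =
    inj₂ (x≢⊥ ∘ proj₁ , isInf-intro lower (inj₂ (_ , _ , feas , cong finE v≡l-m)))
    where
    lower : ∀ w → FeasibleGap x y w → finE v ≤E w
    lower _ (_ , _ , feas' , refl) = minimal feas'

  feasible-refl : ∀ {n} (x : Vecm n) → Feasible x x 0# 0#
  feasible-refl x k = fin-⊕-≤m (x k) ≤-refl , ≤m-fin-⊕ (x k) ≤-refl

  hilbertDist-self : ∀ {n} {x : Vecm n} → ¬ IsBot x → HilbertDist x x (finE 0#)
  hilbertDist-self {x = x} x≢⊥ =
    hilbertDist-minimum x≢⊥ (feasible-refl x) (sym (-‿inverseʳ 0#)) (finE≤ ∘ feasible⇒0≤l-m x≢⊥)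

  distSet-lower : ∀ {n} {x a : Vecm n} {v} → ¬ IsBot x →
                  (∀ {y l m} → InH a y → Feasible x y l m → v ≤E finE (l - m)) →
                  ∀ w → DistSet x a w → v ≤E w
  distSet-lower x≢⊥ bound w (y , y∈H , inj₁ (x≡⊥ , _)) = ⊥-elim (x≢⊥ x≡⊥)
  distSet-lower x≢⊥ bound w (y , y∈H , inj₂ (_ , _ , greatest)) = greatest _ lower
    where
    lower : ∀ w → FeasibleGap _ y w → _ ≤E w
    lower _ (l , m , feas , refl) = bound y∈H feas

  inH-intro : ∀ {n} {a y : Vecm n} {i j t} → i ≢ j → (a i ⊕ y i) ≡ t → (a j ⊕ y j) ≡ t →
              (∀ k → (a k ⊕ y k) ≤m t) → InH a y
  inH-intro i≢j tᵢ≡t tⱼ≡t below =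
    _ , _ , i≢j , trans tᵢ≡t (sym tⱼ≡t) , subst (_ ≤m_) (sym tᵢ≡t) ∘ below

  inH-allInfinite : ∀ {n} {x a : Vecm n} → ¬ IsBot x → ¬ IsBot a →
                    (∀ j → (x j ⊕ a j) ≡ -∞) → InH a x
  inH-allInfinite {x = x} {a} x≢⊥ a≢⊥ infinite with nonBot⇒finite x≢⊥ | nonBot⇒finite a≢⊥
  ... | k , c , xk≡c | k' , c' , ak'≡c' =
    inH-intro k≢k' (infinite' k) (infinite' k') (≤m-reflexive ∘ infinite')
    where
    infinite' : ∀ j → (a j ⊕ x j) ≡ -∞
    infinite' j = trans (⊕-comm (a j) (x j)) (infinite j)
    k≢k' : k ≢ k'
    k≢k' refl = fin≢-∞ (trans (sym (cong₂ _⊕_ xk≡c ak'≡c')) (infinite k))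

  inH-other-maximiser : ∀ {n} {a y : Vecm n} → InH a y → ∀ i* →
                        ∃ λ p → p ≢ i* × (∀ k → (a k ⊕ y k) ≤m (a p ⊕ y p))
  inH-other-maximiser (i , j , i≢j , tᵢ≡tⱼ , tᵢ-max) i* with i ≟ i*
  ... | yes refl = j , i≢j ∘ sym , subst (_ ≤m_) tᵢ≡tⱼ ∘ tᵢ-max
  ... | no i≢i*  = i , i≢i* , tᵢ-max

  feasible-upper : ∀ {n} {x a y : Vecm n} {l m} → Feasible x y l m → ∀ k →
                   (x k ⊕ a k) ≤m (fin l ⊕ (a k ⊕ y k))
  feasible-upper {x = x} {a} {y} {l} feas k = begin
    x k ⊕ a k           ≲⟨ ⊕-monoˡ-≤m (a k) (proj₂ (feas k)) ⟩
    (fin l ⊕ y k) ⊕ a k ≡⟨ xy∙z≈x∙zy (fin l) (y k) (a k) ⟩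
    fin l ⊕ (a k ⊕ y k) ∎
    where open Relation.Binary.Reasoning.Preorder ≤m-preorder

  feasible-lower : ∀ {n} {x a y : Vecm n} {l m} → Feasible x y l m → ∀ k →
                   (fin m ⊕ (a k ⊕ y k)) ≤m (x k ⊕ a k)
  feasible-lower {x = x} {a} {y} {m = m} feas k = begin
    fin m ⊕ (a k ⊕ y k) ≡⟨ xy∙z≈x∙zy (fin m) (y k) (a k) ⟨
    (fin m ⊕ y k) ⊕ a k ≲⟨ ⊕-monoˡ-≤m (a k) (proj₁ (feas k)) ⟩
    x k ⊕ a k           ∎
    where open Relation.Binary.Reasoning.Preorder ≤m-preorder

  inH-feasible-bound : ∀ {n} {x a y : Vecm n} {l m} → InH a y → Feasible x y l m → ∀ i* →
                       (fin m ⊕ (x i* ⊕ a i*)) ≤m (fin l ⊕ maxExcept (λ j → x j ⊕ a j) i*)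
  inH-feasible-bound {x = x} {a} {y} {l} {m} y∈H feas i* with inH-other-maximiser y∈H i*
  ... | p , p≢i* , tₚ-max = begin
    fin m ⊕ (x i* ⊕ a i*)           ≲⟨ ⊕-monoʳ-≤m (fin m) (feasible-upper {a = a} feas i*) ⟩
    fin m ⊕ (fin l ⊕ (a i* ⊕ y i*)) ≲⟨ ⊕-monoʳ-≤m (fin m) (⊕-monoʳ-≤m (fin l) (tₚ-max i*)) ⟩
    fin m ⊕ (fin l ⊕ (a p ⊕ y p))   ≡⟨ x∙yz≈y∙xz (fin m) (fin l) (a p ⊕ y p) ⟩
    fin l ⊕ (fin m ⊕ (a p ⊕ y p))   ≲⟨ ⊕-monoʳ-≤m (fin l) (feasible-lower {a = a} feas p) ⟩
    fin l ⊕ (x p ⊕ a p)             ≲⟨ ⊕-monoʳ-≤m (fin l) (maxExcept-upper _ p≢i*) ⟩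
    fin l ⊕ maxExcept _ i*          ∎
    where open Relation.Binary.Reasoning.Preorder ≤m-preorder

  ⊖-bound : ∀ {l m} M S → (fin m ⊕ M) ≤m (fin l ⊕ S) → 0# ≤ l - m → (M ⊖ S) ≤E finE (l - m)
  ⊖-bound -∞      -∞      _        0≤l-m = finE≤ 0≤l-m
  ⊖-bound -∞      (fin _) _        _     = ninf≤
  ⊖-bound (fin _) -∞      ()       _
  ⊖-bound (fin _) (fin _) (fin≤ p) _     = finE≤ (m+a≤l+b⇒a-b≤l-m p)

  maxGap : ∀ {n} → Vecm n → Vecm n → Fin n → Ext
  maxGap x a i* = (x i* ⊕ a i*) ⊖ maxExcept (λ j → x j ⊕ a j) i*

  maxGap≤feasibleGap : ∀ {n} {x a y : Vecm n} {l m} → ¬ IsBot x → InH a y → Feasible x y l m →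
                       ∀ i* → maxGap x a i* ≤E finE (l - m)
  maxGap≤feasibleGap x≢⊥ y∈H feas i* =
    ⊖-bound _ _ (inH-feasible-bound y∈H feas i*) (feasible⇒0≤l-m x≢⊥ feas)

  lowerAt : ∀ {n} → Vecm n → Fin n → Carrier → Vecm n
  lowerAt x i δ = updateAt x i (fin (- δ) ⊕_)

  lowerAt-feasible : ∀ {n} (x : Vecm n) i {δ} → 0# ≤ δ → Feasible x (lowerAt x i δ) δ 0#
  lowerAt-feasible x i {δ} 0≤δ k = coordinate (k ≟ i)
    where
    Sandwiched : Rmax → Rmax → Set
    Sandwiched X Y = ((fin 0# ⊕ Y) ≤m X) × (X ≤m (fin δ ⊕ Y))
    lowered : ∀ X → Sandwiched X (fin (- δ) ⊕ X)
    lowered X =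
      subst (_≤m X) (⊕-assoc (fin 0#) (fin (- δ)) X)
            (fin-⊕-≤m X (subst (_≤ 0#) (sym (+-identityˡ (- δ))) (0≤x⇒-x≤0 0≤δ))) ,
      subst (X ≤m_) (⊕-assoc (fin δ) (fin (- δ)) X)
            (≤m-fin-⊕ X (subst (0# ≤_) (sym (-‿inverseʳ δ)) ≤-refl))
    coordinate : Dec (k ≡ i) → Sandwiched (x k) (lowerAt x i δ k)
    coordinate (yes refl) = subst (Sandwiched (x k)) (sym (updateAt-updates k x)) (lowered (x k))
    coordinate (no k≢i)   = subst (Sandwiched (x k)) (sym (updateAt-minimal k i x k≢i))
                                  (fin-⊕-≤m (x k) ≤-refl , ≤m-fin-⊕ (x k) 0≤δ)

  lowerAt-inH : ∀ {n} {x a : Vecm n} {μ σ} i* → (x i* ⊕ a i*) ≡ fin μ →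
                maxExcept (λ j → x j ⊕ a j) i* ≡ fin σ → InH a (lowerAt x i* (μ - σ))
  lowerAt-inH {x = x} {a} {μ} {σ} i* sᵢ*≡μ S≡σ with maxExcept-attained _ i* S≡σ
  ... | j , j≢i* , sⱼ≡σ = inH-intro (j≢i* ∘ sym) top (trans (others j≢i*) sⱼ≡σ) below
    where
    δ = μ - σ
    y = lowerAt x i* δ
    others : ∀ {k} → k ≢ i* → (a k ⊕ y k) ≡ (x k ⊕ a k)
    others {k} k≢i* = trans (cong (a k ⊕_) (updateAt-minimal k i* x k≢i*)) (⊕-comm (a k) (x k))
    top : (a i* ⊕ y i*) ≡ fin σ
    top = begin
      a i* ⊕ y i*               ≡⟨ cong (a i* ⊕_) (updateAt-updates i* x) ⟩
      a i* ⊕ (fin (- δ) ⊕ x i*) ≡⟨ x∙yz≈y∙zx (a i*) (fin (- δ)) (x i*) ⟩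
      fin (- δ) ⊕ (x i* ⊕ a i*) ≡⟨ cong (fin (- δ) ⊕_) sᵢ*≡μ ⟩
      fin (- δ + μ)             ≡⟨ cong fin (-[a-b]+a≡b μ σ) ⟩
      fin σ                     ∎
      where open ≡-Reasoning
    below : ∀ k → (a k ⊕ y k) ≤m fin σ
    below k with k ≟ i*
    ... | yes refl = ≤m-reflexive top
    ... | no k≢i*  = subst₂ _≤m_ (sym (others k≢i*)) S≡σ (maxExcept-upper _ k≢i*)

  maxGap-attained-finite : ∀ {n} {x a : Vecm n} {μ σ} → ¬ IsBot x → ∀ i* →
                           (x i* ⊕ a i*) ≡ fin μ → maxExcept (λ j → x j ⊕ a j) i* ≡ fin σ → σ ≤ μ →
                           DistSet x a (finE (μ - σ))
  maxGap-attained-finite {x = x} x≢⊥ i* sᵢ*≡μ S≡σ σ≤μ =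
    lowerAt x i* _ , y∈H ,
    hilbertDist-minimum x≢⊥ (lowerAt-feasible x i* (x≤y⇒0≤y-x σ≤μ)) (sym (x-0≡x _)) minimal
    where
    y∈H = lowerAt-inH i* sᵢ*≡μ S≡σ
    minimal : ∀ {l m} → Feasible x (lowerAt x i* _) l m → _ ≤E finE (l - m)
    minimal feas = subst (_≤E _) (cong₂ _⊖_ sᵢ*≡μ S≡σ) (maxGap≤feasibleGap x≢⊥ y∈H feas i*)

  maxGap-attained : ∀ {n} {x a : Vecm n} → ¬ IsBot x → ¬ IsBot a → ∀ i* →
                    (∀ j → (x j ⊕ a j) ≤m (x i* ⊕ a i*)) →
                    maxGap x a i* ≡ pinf ⊎ DistSet x a (maxGap x a i*)
  maxGap-attained {x = x} {a} x≢⊥ a≢⊥ i* i*-max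
    with x i* ⊕ a i* in sᵢ*≡ | maxExcept (λ j → x j ⊕ a j) i* in S≡
       | maxExcept-least (λ j → x j ⊕ a j) i* (λ j _ → i*-max j)
  ... | -∞    | -∞    | _        = inj₂ (x , inH-allInfinite x≢⊥ a≢⊥ infinite , hilbertDist-self x≢⊥)
    where
    infinite : ∀ j → (x j ⊕ a j) ≡ -∞
    infinite j = x≤m-∞⇒x≡-∞ (subst (_ ≤m_) sᵢ*≡ (i*-max j))
  ... | -∞    | fin _ | ()
  ... | fin _ | -∞    | _        = inj₁ refl
  ... | fin _ | fin _ | fin≤ σ≤μ = inj₂ (maxGap-attained-finite x≢⊥ i* sᵢ*≡ S≡ σ≤μ)

lemma4p1 : (R : Reals) → ∀ {n} (x a : Fin n → Over.Rmax R) →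
           ¬ Over.IsBot R x → ¬ Over.IsBot R a →
           (i* : Fin n) →
           (∀ j → Over._≤m_ R (Over._⊕_ R (x j) (a j)) (Over._⊕_ R (x i*) (a i*))) →
           Over.IsDistH R x a
             (Over._⊖_ R (Over._⊕_ R (x i*) (a i*))
                         (Over.maxExcept R (λ j → Over._⊕_ R (x j) (a j)) i*))
lemma4p1 R x a x≢⊥ a≢⊥ i* i*-max =
  isInf-intro (distSet-lower x≢⊥ (λ y∈H feas → maxGap≤feasibleGap x≢⊥ y∈H feas i*))
              (maxGap-attained x≢⊥ a≢⊥ i* i*-max)
  where open HyperplaneDistance R
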